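{- Let $\Gamma\cup\{A\}$ be a sharing-free set of named formulas with $A$ sharing no name with $\Gamma$, and let bl-graphs $G,H$ be total with respect to the sequents $\vdash\Gamma,A$ and $\vdash\Gamma,\bar A$ respectively. Then $G\odot_{\mathrm{names}(A)}H$ is total with respect to $\vdash\Gamma$.
   Context: Named formulas and sequents. Fix a countably infinite set $\mathcal N$ of names and a set $\mathcal A$ of atoms with a fixpoint-free involution $\alpha\mapsto\bar\alpha$. Named formulas: $A,B::=\alpha^x\mid A\lor B\mid A\land B$ ($\alpha\in\mathcal A$, $x\in\mathcal N$); formulas $\alpha^x$ are atomic. Negation: $\overline{\alpha^x}=\bar\alpha^x$, $\overline{A\lor B}=\bar A\land\bar B$, $\overline{A\land B}=\bar A\lor\bar B$ (names preserved, so $\mathrm{names}(\bar A)=\mathrm{names}(A)$). $\mathrm{names}(A)$ is the set of names in $A$, $\mathrm{names}(\Gamma)=\bigcup_{A\in\Gamma}\mathrm{names}(A)$. A formula is sharing-free if each name occurs in it at most once; a set is sharing-free if its members are sharing-free with pairwise disjoint name sets. A sequent $\vdash\Gamma$ is a finite sharing-free set $\Gamma$; $\Gamma,A=\Gamma\cup\{A\}$. For sharing-free $\Gamma$ and $x\in\mathrm{names}(\Gamma)$, $\Gamma[x]$ is the unique atom $\alpha$ with $\alpha^x$ a subformula of a member of $\Gamma$. Branches. $\mathrm{Br}(\alpha^x)=\{\{x\}\}$, $\mathrm{Br}(B\lor C)=\{X\cup Y\mid X\in\mathrm{Br}(B),Y\in\mathrm{Br}(C)\}$, $\mathrm{Br}(B\land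 C)=\mathrm{Br}(B)\cup\mathrm{Br}(C)$; for sharing-free $\Gamma$, $\mathrm{Br}(\Gamma)=\{X\subseteq\mathrm{names}(\Gamma)\mid\forall A\in\Gamma,\ X\cap\mathrm{names}(A)\in\mathrm{Br}(A)\}$. Branch-labeled graphs. A bl-graph is $G=\langle V_G,\triangleleft_G\rangle$ with $V_G\subseteq\mathcal N$ and $\triangleleft_G$ a relation between 2-element subsets $e$ of $V_G$ and subsets $X\subseteq V_G$ such that $e\triangleleft_G X$ implies $e\subseteq X$; edges $E_G=\{e\mid\exists X.\,e\triangleleft_G X\}$, branches $\mathrm{Br}(G)=\{X\mid\exists e.\,e\triangleleft_G X\}$. For $I\subseteq\mathcal N$: $e\triangleleft^I_G X$ iff $e\triangleleft_G Y$ for some $Y$ with $X=Y\setminus I$. An alternating $X$-labeled path between bl-graphs $G,H$ through $I$ is a sequence $x_1,\dots,x_n$ ($n>1$) of pairwise distinct vertices of $G$ or $H$ with $x_i\in I$ for $1<i<n$ such that either $x_ix_{i+1}\triangleleft^I_G X$ for all odd $i$ and $x_ix_{i+1}\triangleleft^I_H X$ for all even $i$, or the same with $G,H$ swapped; it is complete if $x_1,x_n\notin I$. $G\odot_I H$ has vertex set $V=(V_G\cup V_H)\setminus I$ and, for $x\ne y\in V$, $X\subseteq V$, $xy\triangleleft X$ iff there is a complete alternating $X$-labeled path from $x$ to $y$ between $G$ and $H$ through $I$. Totality. A bl-graph $G$ is total w.r.t. a sharing-free sequent $\vdash\Gamma$ iff (i) $V_G=\mathrm{names}(\Gamma)$;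 (ii) $\mathrm{Br}(G)=\mathrm{Br}(\Gamma)$; (iii) for all $xy\in E_G$, $\Gamma[x]=\overline{\Gamma[y]}$. -}

module Defs where

open import Level using (Level; 0ℓ; Lift) renaming (suc to lsuc)
open import Data.Nat using (ℕ)
open import Data.List using (List; []; _∷_; _++_; [_])
open import Data.List.Relation.Unary.All using (All)
open import Data.List.Relation.Unary.AllPairs using (AllPairs)
open import Data.List.Relation.Unary.Unique.Propositional using (Unique)
import Data.List.Membership.Propositional as LM
open import Data.Product using (Σ; ∃; ∃-syntax; _×_; _,_)
open import Data.Sum using (_⊎_)
open import Data.Unit.Polymorphic using (⊤)
open import Relation.Nullary using (¬_)
open import Relation.Binary.PropositionalEquality using (_≡_; _≢_)
open import Relation.Unary using (Pred; _∈_; _∉_; _∪_; _∩_; _∖_; _⊆_; _≐_; Empty)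

Name : Set
Name = ℕ

NSet : Set₁
NSet = Pred Name 0ℓ

Disj : NSet → NSet → Set
Disj P Q = Empty (P ∩ Q)

data Formula (Atom : Set) : Set where
  at   : Atom → Name → Formula Atom
  _∨ᶠ_ : Formula Atom → Formula Atom → Formula Atom
  _∧ᶠ_ : Formula Atom → Formula Atom → Formula Atom

module _ {Atom : Set} where

  neg : (Atom → Atom) → Formula Atom → Formula Atom
  neg bar (at α x) = at (bar α) x
  neg bar (B ∨ᶠ C) = neg bar B ∧ᶠ neg bar C
  neg bar (B ∧ᶠ C) = neg bar B ∨ᶠ neg bar C

  names : Formula Atom → NSet
  names (at α x) = λ z → z ≡ x
  names (B ∨ᶠ C) = names B ∪ names C
  names (B ∧ᶠ C) = names B ∪ names C

  namesL : List (Formula Atom) → NSet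
  namesL []      = Relation.Unary.∅
  namesL (A ∷ Γ) = names A ∪ namesL Γ

  SharingFreeF : Formula Atom → Set
  SharingFreeF (at α x) = ⊤
  SharingFreeF (B ∨ᶠ C) = SharingFreeF B × SharingFreeF C × Disj (names B) (names C)
  SharingFreeF (B ∧ᶠ C) = SharingFreeF B × SharingFreeF C × Disj (names B) (names C)

  SharingFree : List (Formula Atom) → Set
  SharingFree Γ = All SharingFreeF Γ × AllPairs (λ A B → Disj (names A) (names B)) Γ

  AtomIn : Atom → Name → Formula Atom → Set
  AtomIn α x (at β y) = (α ≡ β) × (x ≡ y)
  AtomIn α x (B ∨ᶠ C) = AtomIn α x B ⊎ AtomIn α x C
  AtomIn α x (B ∧ᶠ C) = AtomIn α x B ⊎ AtomIn α x C

  AtomAt : List (Formula Atom) → Name → Atom → Set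
  AtomAt Γ x α = ∃[ A ] (A LM.∈ Γ × AtomIn α x A)

  BrF : Formula Atom → NSet → Set₁
  BrF (at α x) Z = Lift _ (Z ≐ (λ z → z ≡ x))
  BrF (B ∨ᶠ C) Z = ∃[ X ] ∃[ Y ] (BrF B X × BrF C Y × Z ≐ (X ∪ Y))
  BrF (B ∧ᶠ C) Z = BrF B Z ⊎ BrF C Z

  BrL : List (Formula Atom) → NSet → Set₁
  BrL Γ X = X ⊆ namesL Γ × All (λ A → BrF A (X ∩ names A)) Γ

-- Branch-labeled graphs: vertex set and labeled-edge relation
-- `rel x y X` meaning {x,y} ◁ X.
record RawBL : Set₂ where
  field
    V   : NSet
    rel : Name → Name → NSet → Set₁
open RawBL public

record IsBLGraph (G : RawBL) : Set₁ where
  field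
    rel-≢    : ∀ {x y X} → rel G x y X → x ≢ y
    rel-sym  : ∀ {x y X} → rel G x y X → rel G y x X
    rel-ext  : ∀ {x y X Y} → rel G x y X → X ≐ Y → rel G x y Y
    rel-V    : ∀ {x y X} → rel G x y X → X ⊆ V G
    rel-edge : ∀ {x y X} → rel G x y X → x ∈ X × y ∈ X

BrG : RawBL → NSet → Set₁
BrG G X = ∃[ x ] ∃[ y ] ∃[ Y ] (rel G x y Y × Y ≐ X)

RelI : RawBL → NSet → Name → Name → NSet → Set₁
RelI G I x y X = ∃[ Y ] (rel G x y Y × X ≐ (Y ∖ I))

Alt : RawBL → RawBL → NSet → NSet → List Name → Set₁
Alt G H I X []            = ⊤
Alt G H I X (x ∷ [])      = ⊤
Alt G H I X (x ∷ y ∷ p)   = RelI G I x y X × Alt H G I X (y ∷ p)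

CompletePath : RawBL → RawBL → NSet → NSet → Name → Name → Set₁
CompletePath G H I X x y =
  ∃[ mid ] (let p = x ∷ mid ++ [ y ] in
    All (_∈ I) mid × x ∉ I × y ∉ I
    × Unique p × All (_∈ (V G ∪ V H)) p
    × (Alt G H I X p ⊎ Alt H G I X p))

_⊙[_]_ : RawBL → NSet → RawBL → RawBL
G ⊙[ I ] H = record
  { V   = VV
  ; rel = λ x y X → x ≢ y × x ∈ VV × y ∈ VV × X ⊆ VV × CompletePath G H I X x y }
  where
    VV : NSet
    VV = (V G ∪ V H) ∖ I

record Total {Atom : Set} (bar : Atom → Atom) (G : RawBL) (Γ : List (Formula Atom)) : Set₂ where
  field
    tot-V   : V G ≐ namesL Γ
    tot-Br  : ∀ (X : NSet) → (BrG G X → BrL Γ X) × (BrL Γ X → BrG G X)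
    tot-ax  : ∀ {x y X α β} → rel G x y X → AtomAt Γ x α → AtomAt Γ y β → α ≡ bar β

module Submission where

-- The vertex and axiom conditions are local. A complete alternating path starts and ends
-- outside names(A); crossing a name of A it passes from one premise to the other, and since
-- negation flips exactly the atoms on names(A) the atom seen along the path is passed on
-- dually, so the endpoints carry dual atoms. The first edge of a path is an edge of G or H
-- labelled by a branch of Γ,A or Γ,Ā, and removing names(A) leaves a branch of Γ.
--
-- The substance is that every X ∈ Br(Γ) labels an edge of G ⊙ H. By totality every branch
-- l of A yields an edge of G labelled X ∪ l, and every branch of Ā an edge of H labelled
-- X ∪ l; only these finitely many edges are used. If they admitted no complete alternating
-- walk, give every name of A a side, G or H, through which it is never reached, splitting
-- unreached names by a colouring that separates complementary atoms. The branches of A and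
-- Ā are complementary, so some chosen edge has its inner endpoints on its own side. That is
-- impossible: such an edge is a complete walk itself, or it leads from a reached name into
-- its own side, or it joins two unreached names with complementary atoms and equal colour.
-- The argument is classical, but a walk shortcuts to a path with at most |names(A)| inner
-- vertices, so a complete path is then found by finite search.

open import Defs
open import Level using (lift)
open import Data.Bool.Base using (Bool; true; false; not; if_then_else_)
open import Data.Bool.Properties using (not-involutive; not-¬) renaming (_≟_ to _≟ᵇ_)
open import Data.Empty using (⊥; ⊥-elim)
open import Data.List.Base using (List; []; _∷_; _++_; [_]; length; map; cartesianProduct; cartesianProductWith)
open import Data.List.Properties using (length-removeAt′)
open import Data.List.Membership.Propositional using (_∈_; _∉_; mapWith∈; lose; find)
open import Data.List.Membership.Propositional.Properties
  using ( ∈-++⁺ˡ; ∈-++⁺ʳ; ∈-++⁻; ∈-map⁺; ∈-cartesianProduct⁺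
        ; ∈-cartesianProductWith⁺; ∈-cartesianProductWith⁻)
open import Data.List.Relation.Unary.All using (All; []; _∷_)
import Data.List.Relation.Unary.All as All
import Data.List.Relation.Unary.All.Properties as All
open import Data.List.Relation.Unary.All.Properties.Core using (¬Any⇒All¬)
open import Data.List.Relation.Unary.Any using (Any; here; there; any?; index; _─_)
import Data.List.Relation.Unary.Any as Any
import Data.List.Relation.Unary.Any.Properties as AnyP
open import Data.List.Relation.Unary.AllPairs using ([]; _∷_)
open import Data.List.Relation.Unary.Unique.Propositional using (Unique)
import Data.List.Relation.Unary.Unique.Propositional.Properties as UniqueP
open import Data.Maybe.Base using (Maybe; just; nothing; _<∣>_)
import Data.Maybe.Base as Maybe
open import Data.Maybe.Properties using (just-injective)
open import Data.Nat.Base using (ℕ; zero; suc; _≤_; z≤n; s≤s)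
import Data.Nat.Properties as ℕ
open import Data.Product using (∃; ∃-syntax; _×_; _,_; proj₁; proj₂; map₁; map₂)
open import Data.Product.Properties using (≡-dec)
open import Data.Sum using (_⊎_; inj₁; inj₂; [_,_]′)
import Data.Sum
open import Data.Unit.Base using (⊤; tt)
open import Function using (_∘_; id)
open import Relation.Binary.Definitions using (DecidableEquality)
open import Relation.Binary.PropositionalEquality
  using (_≡_; _≢_; refl; sym; trans; cong; cong₂; subst; subst₂; module ≡-Reasoning)
open import Relation.Nullary using (¬_; Dec; yes; no; ¬?)
open import Relation.Nullary.Decidable using (_×-dec_; _⊎-dec_; map′; ¬¬-excluded-middle)
open import Relation.Unary using (Decidable; _∪_; _∩_; _∖_; _⊆_; _≐_)
open import Relation.Unary.Properties using (≐-refl; ≐-sym; ≐-trans)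

-- Chains of a relation and finite search

module _ {S : Set} (R : S → S → Set) where

  Chain : (S → Set) → S → List S → Set
  Chain F s []       = F s
  Chain F s (t ∷ ts) = R s t × Chain F t ts

  Chain-snoc : ∀ {s t u} ts → Chain (_≡ t) s ts → R t u → Chain (_≡ u) s (ts ++ [ u ])
  Chain-snoc []       refl     r = r , refl
  Chain-snoc (_ ∷ ts) (r′ , c) r = r′ , Chain-snoc ts c r

  Chain-++ : ∀ {F : S → Set} {s t} ts us → Chain (_≡ t) s ts → Chain F t us → Chain F s (ts ++ us)
  Chain-++ []       us refl     c′ = c′
  Chain-++ (_ ∷ ts) us (r , c) c′ = r , Chain-++ ts us c c′

  Chain-final : ∀ {F : S → Set} s ts → Chain F s ts → ∃ F
  Chain-final s []       f       = s , f
  Chain-final s (t ∷ ts) (_ , c) = Chain-final t ts c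

  module _ (_≟_ : DecidableEquality S) {F : S → Set} where
    open import Data.List.Membership.DecPropositional _≟_ using (_∈?_)

    private
      dropUntil : ∀ {s} t us → Chain F t us → Unique (t ∷ us) → s ∈ t ∷ us →
                  ∃[ vs ] (Chain F s vs × Unique (s ∷ vs))
      dropUntil t us       c       u       (here refl) = us , c , u
      dropUntil t (v ∷ us) (_ , c) (_ ∷ u) (there s∈)  = dropUntil v us c u s∈

    Chain-shortcut : ∀ s ts → Chain F s ts → ∃[ us ] (Chain F s us × Unique (s ∷ us))
    Chain-shortcut s []       f       = [] , f , [] ∷ []
    Chain-shortcut s (t ∷ ts) (r , c) with Chain-shortcut t ts c
    ... | us , c′ , u with s ∈? t ∷ us
    ...   | yes s∈ = dropUntil t us c′ u s∈
    ...   | no  s∉ = t ∷ us , (r , c′) , ¬Any⇒All¬ (t ∷ us) s∉ ∷ u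

module _ {A : Set} where

  private
    ∈-─ : ∀ {x z : A} {ys} (x∈ys : x ∈ ys) → z ∈ ys → z ≢ x → z ∈ (ys ─ x∈ys)
    ∈-─ (here refl) (here refl) z≢x = ⊥-elim (z≢x refl)
    ∈-─ (here refl) (there z∈) _    = z∈
    ∈-─ (there x∈)  (here refl) _   = here refl
    ∈-─ (there x∈)  (there z∈) z≢x  = there (∈-─ x∈ z∈ z≢x)

  Unique-length≤ : ∀ {xs ys : List A} → Unique xs → All (_∈ ys) xs → length xs ≤ length ys
  Unique-length≤ {[]}     _            _               = z≤n
  Unique-length≤ {x ∷ xs} {ys} (x∉xs ∷ u) (x∈ys ∷ xs⊆ys) =
    subst (suc (length xs) ≤_) (sym (length-removeAt′ ys (index x∈ys)))
      (s≤s (Unique-length≤ u (All.zipWith (λ (z∈ , x≢z) → ∈-─ x∈ys z∈ (x≢z ∘ sym))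
                                          (xs⊆ys , x∉xs))))

  Unique-++⁻ˡ : ∀ (xs : List A) {ys} → Unique (xs ++ ys) → Unique xs
  Unique-++⁻ˡ []       _          = []
  Unique-++⁻ˡ (x ∷ xs) (x∉ ∷ u) = All.++⁻ˡ xs x∉ ∷ Unique-++⁻ˡ xs u

  ¬¬-decidable : {P : A → Set} → DecidableEquality A → (L : List A) → (∀ {a} → P a → a ∈ L) →
                 ¬ ¬ Decidable P
  ¬¬-decidable {P} _≟_ L P⊆L ¬dec = decideEach L λ dec → ¬dec λ a → decide a (dec {a})
    where
      open import Data.List.Membership.DecPropositional _≟_ using (_∈?_)
      decideEach : ∀ L → ¬ ¬ (∀ {a} → a ∈ L → Dec (P a))
      decideEach []      k = k λ ()
      decideEach (x ∷ L) k =
        ¬¬-excluded-middle λ Px? → decideEach L λ dec →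
        k λ { (here refl) → Px? ; (there a∈) → dec a∈ }
      decide : ∀ a → (a ∈ L → Dec (P a)) → Dec (P a)
      decide a dec with a ∈? L
      ... | yes a∈ = dec a∈
      ... | no  a∉ = no (a∉ ∘ P⊆L)

  Bounded : List A → ℕ → (List A → Set) → Set
  Bounded U k P = ∃[ xs ] (length xs ≤ k × All (_∈ U) xs × P xs)

  boundedSearch : ∀ (U : List A) {P : List A → Set} → Decidable P → ∀ k → Dec (Bounded U k P)
  boundedSearch U P? zero =
    map′ (λ p → [] , z≤n , [] , p) (λ { ([] , _ , _ , p) → p }) (P? [])
  boundedSearch U {P} P? (suc k) =
    map′ extend shrink (P? [] ⊎-dec any? (λ x → boundedSearch U (P? ∘ (x ∷_)) k) U)
    where
      extend : P [] ⊎ Any (λ x → Bounded U k (P ∘ (x ∷_))) U → Bounded U (suc k) P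
      extend (inj₁ p) = [] , z≤n , [] , p
      extend (inj₂ found) with find found
      ... | x , x∈U , xs , len , xs⊆U , p = x ∷ xs , s≤s len , x∈U ∷ xs⊆U , p
      shrink : Bounded U (suc k) P → P [] ⊎ Any (λ x → Bounded U k (P ∘ (x ∷_))) U
      shrink ([]     , _       , _          , p) = inj₁ p
      shrink (x ∷ xs , s≤s len , x∈U ∷ xs⊆U , p) = inj₂ (lose x∈U (xs , len , xs⊆U , p))

-- Names, atoms and branches of named formulas

module _ {Atom : Set} where

  nameList : Formula Atom → List Name
  nameList (at α x) = [ x ]
  nameList (B ∨ᶠ C) = nameList B ++ nameList C
  nameList (B ∧ᶠ C) = nameList B ++ nameList C

  ∈-nameList⁻ : ∀ (A : Formula Atom) {x} → x ∈ nameList A → names A x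
  ∈-nameList⁻ (at α x) (here refl) = refl
  ∈-nameList⁻ (B ∨ᶠ C) x∈ with ∈-++⁻ (nameList B) x∈
  ... | inj₁ x∈B = inj₁ (∈-nameList⁻ B x∈B)
  ... | inj₂ x∈C = inj₂ (∈-nameList⁻ C x∈C)
  ∈-nameList⁻ (B ∧ᶠ C) x∈ with ∈-++⁻ (nameList B) x∈
  ... | inj₁ x∈B = inj₁ (∈-nameList⁻ B x∈B)
  ... | inj₂ x∈C = inj₂ (∈-nameList⁻ C x∈C)

  ∈-nameList⁺ : ∀ (A : Formula Atom) {x} → names A x → x ∈ nameList A
  ∈-nameList⁺ (at α x) refl       = here refl
  ∈-nameList⁺ (B ∨ᶠ C) (inj₁ x∈B) = ∈-++⁺ˡ (∈-nameList⁺ B x∈B)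
  ∈-nameList⁺ (B ∨ᶠ C) (inj₂ x∈C) = ∈-++⁺ʳ (nameList B) (∈-nameList⁺ C x∈C)
  ∈-nameList⁺ (B ∧ᶠ C) (inj₁ x∈B) = ∈-++⁺ˡ (∈-nameList⁺ B x∈B)
  ∈-nameList⁺ (B ∧ᶠ C) (inj₂ x∈C) = ∈-++⁺ʳ (nameList B) (∈-nameList⁺ C x∈C)

  names-disjoint : ∀ (A : Formula Atom) (Γ : List (Formula Atom)) → All (Disj (names A) ∘ names) Γ →
                   ∀ {x} → namesL Γ x → ¬ names A x
  names-disjoint A (B ∷ Γ) (d ∷ _)  (inj₁ x∈B) x∈A = d _ (x∈A , x∈B)
  names-disjoint A (B ∷ Γ) (_ ∷ ds) (inj₂ x∈Γ) x∈A = names-disjoint A Γ ds x∈Γ x∈A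

  atomOf : Formula Atom → Name → Maybe Atom
  atomOf (at α x) z with z ℕ.≟ x
  ... | yes _ = just α
  ... | no  _ = nothing
  atomOf (B ∨ᶠ C) z = atomOf B z <∣> atomOf C z
  atomOf (B ∧ᶠ C) z = atomOf B z <∣> atomOf C z

  atomsOf : List (Formula Atom) → Name → Maybe Atom
  atomsOf []      z = nothing
  atomsOf (B ∷ Γ) z = atomOf B z <∣> atomsOf Γ z

  atomOf-∉ : ∀ (A : Formula Atom) {z} → ¬ names A z → atomOf A z ≡ nothing
  atomOf-∉ (at α x) {z} z∉ with z ℕ.≟ x
  ... | yes z≡x = ⊥-elim (z∉ z≡x)
  ... | no  _   = refl
  atomOf-∉ (B ∨ᶠ C) z∉ rewrite atomOf-∉ B (z∉ ∘ inj₁) = atomOf-∉ C (z∉ ∘ inj₂)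
  atomOf-∉ (B ∧ᶠ C) z∉ rewrite atomOf-∉ B (z∉ ∘ inj₁) = atomOf-∉ C (z∉ ∘ inj₂)

  AtomIn⇒names : ∀ (A : Formula Atom) {α x} → AtomIn α x A → names A x
  AtomIn⇒names (at β y) (_ , x≡y) = x≡y
  AtomIn⇒names (B ∨ᶠ C) (inj₁ p)  = inj₁ (AtomIn⇒names B p)
  AtomIn⇒names (B ∨ᶠ C) (inj₂ p)  = inj₂ (AtomIn⇒names C p)
  AtomIn⇒names (B ∧ᶠ C) (inj₁ p)  = inj₁ (AtomIn⇒names B p)
  AtomIn⇒names (B ∧ᶠ C) (inj₂ p)  = inj₂ (AtomIn⇒names C p)

  names⇒AtomIn : ∀ (A : Formula Atom) {x} → names A x → ∃[ α ] AtomIn α x A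
  names⇒AtomIn (at β y) x≡y = β , refl , x≡y
  names⇒AtomIn (B ∨ᶠ C) (inj₁ x∈B) = map₂ inj₁ (names⇒AtomIn B x∈B)
  names⇒AtomIn (B ∨ᶠ C) (inj₂ x∈C) = map₂ inj₂ (names⇒AtomIn C x∈C)
  names⇒AtomIn (B ∧ᶠ C) (inj₁ x∈B) = map₂ inj₁ (names⇒AtomIn B x∈B)
  names⇒AtomIn (B ∧ᶠ C) (inj₂ x∈C) = map₂ inj₂ (names⇒AtomIn C x∈C)

  namesL⇒AtomAt : ∀ (Γ : List (Formula Atom)) {x} → namesL Γ x → ∃[ α ] AtomAt Γ x α
  namesL⇒AtomAt (B ∷ Γ) (inj₁ x∈B) with names⇒AtomIn B x∈B
  ... | α , p = α , B , here refl , p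
  namesL⇒AtomAt (B ∷ Γ) (inj₂ x∈Γ) with namesL⇒AtomAt Γ x∈Γ
  ... | α , C , C∈Γ , p = α , C , there C∈Γ , p

  AtomIn⇒atomOf : ∀ (A : Formula Atom) {α x} → SharingFreeF A → AtomIn α x A → atomOf A x ≡ just α
  AtomIn⇒atomOf (at β y) {x = x} _ (refl , refl) with x ℕ.≟ y
  ... | yes _   = refl
  ... | no  x≢y = ⊥-elim (x≢y refl)
  AtomIn⇒atomOf (B ∨ᶠ C) (sB , _ , _) (inj₁ p) rewrite AtomIn⇒atomOf B sB p = refl
  AtomIn⇒atomOf (B ∨ᶠ C) {x = x} (_ , sC , d) (inj₂ p)
    rewrite atomOf-∉ B {x} (λ x∈B → d _ (x∈B , AtomIn⇒names C p)) = AtomIn⇒atomOf C sC p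
  AtomIn⇒atomOf (B ∧ᶠ C) (sB , _ , _) (inj₁ p) rewrite AtomIn⇒atomOf B sB p = refl
  AtomIn⇒atomOf (B ∧ᶠ C) {x = x} (_ , sC , d) (inj₂ p)
    rewrite atomOf-∉ B {x} (λ x∈B → d _ (x∈B , AtomIn⇒names C p)) = AtomIn⇒atomOf C sC p

  AtomAt⇒atomsOf : ∀ (Γ : List (Formula Atom)) {α x} → SharingFree Γ →
                   AtomAt Γ x α → atomsOf Γ x ≡ just α
  AtomAt⇒atomsOf (B ∷ Γ) (sB ∷ _ , _) (_ , here refl , p) rewrite AtomIn⇒atomOf B sB p = refl
  AtomAt⇒atomsOf (B ∷ Γ) {x = x} (_ ∷ sΓ , d ∷ ds) (C , there C∈Γ , p)
    rewrite atomOf-∉ B {x} (λ x∈B → All.lookup d C∈Γ _ (x∈B , AtomIn⇒names C p)) =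
      AtomAt⇒atomsOf Γ (sΓ , ds) (C , C∈Γ , p)

  branches : Formula Atom → List (List Name)
  branches (at α x) = [ [ x ] ]
  branches (B ∨ᶠ C) = cartesianProductWith _++_ (branches B) (branches C)
  branches (B ∧ᶠ C) = branches B ++ branches C

  branches-⊆ : ∀ (A : Formula Atom) {l} → l ∈ branches A → All (names A) l
  branches-⊆ (at α x) (here refl) = refl ∷ []
  branches-⊆ (B ∨ᶠ C) l∈ with ∈-cartesianProductWith⁻ _++_ (branches B) (branches C) l∈
  ... | l₁ , l₂ , l₁∈ , l₂∈ , refl =
    All.++⁺ (All.map inj₁ (branches-⊆ B l₁∈)) (All.map inj₂ (branches-⊆ C l₂∈))
  branches-⊆ (B ∧ᶠ C) l∈ with ∈-++⁻ (branches B) l∈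
  ... | inj₁ l∈B = All.map inj₁ (branches-⊆ B l∈B)
  ... | inj₂ l∈C = All.map inj₂ (branches-⊆ C l∈C)

  BrF-resp-≐ : ∀ (A : Formula Atom) {X Y} → BrF A X → X ≐ Y → BrF A Y
  BrF-resp-≐ (at α x) (lift X≐x)             X≐Y = lift (≐-trans (≐-sym X≐Y) X≐x)
  BrF-resp-≐ (B ∨ᶠ C) (X₁ , X₂ , b , c , X≐) X≐Y = X₁ , X₂ , b , c , ≐-trans (≐-sym X≐Y) X≐
  BrF-resp-≐ (B ∧ᶠ C) (inj₁ b)               X≐Y = inj₁ (BrF-resp-≐ B b X≐Y)
  BrF-resp-≐ (B ∧ᶠ C) (inj₂ c)               X≐Y = inj₂ (BrF-resp-≐ C c X≐Y)

  branches-BrF : ∀ (A : Formula Atom) {l} → l ∈ branches A → BrF A (_∈ l)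
  branches-BrF (at α x) (here refl) = lift ((λ { (here x≡) → x≡ }) , here)
  branches-BrF (B ∨ᶠ C) l∈ with ∈-cartesianProductWith⁻ _++_ (branches B) (branches C) l∈
  ... | l₁ , l₂ , l₁∈ , l₂∈ , refl =
    (_∈ l₁) , (_∈ l₂) , branches-BrF B l₁∈ , branches-BrF C l₂∈ ,
    ∈-++⁻ l₁ , [ ∈-++⁺ˡ , ∈-++⁺ʳ l₁ ]′
  branches-BrF (B ∧ᶠ C) l∈ with ∈-++⁻ (branches B) l∈
  ... | inj₁ l∈B = inj₁ (branches-BrF B l∈B)
  ... | inj₂ l∈C = inj₂ (branches-BrF C l∈C)

  BrL-resp-≐ : ∀ (Γ : List (Formula Atom)) {X Y} → X ≐ Y → BrL Γ X → BrL Γ Y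
  BrL-resp-≐ Γ (X⊆Y , Y⊆X) (X⊆Γ , bs) =
    X⊆Γ ∘ Y⊆X , All.map (λ {A} b → BrF-resp-≐ A b (map₁ X⊆Y , map₁ Y⊆X)) bs

  BrL-∷⁺ : ∀ {B : Formula Atom} {Γ X l} → All (Disj (names B) ∘ names) Γ →
           BrL Γ X → l ∈ branches B → BrL (B ∷ Γ) (X ∪ (_∈ l))
  BrL-∷⁺ {B} {Γ} {X} {l} disj (X⊆Γ , bs) l∈ = X∪l⊆ , head ∷ All.zipWith tail (bs , disj)
    where
      l⊆B : ∀ {z} → z ∈ l → names B z
      l⊆B = All.lookup (branches-⊆ B l∈)
      X∩B-empty : ∀ {z} → X z → ¬ names B z
      X∩B-empty = names-disjoint B Γ disj ∘ X⊆Γ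
      X∪l⊆ : X ∪ (_∈ l) ⊆ namesL (B ∷ Γ)
      X∪l⊆ (inj₁ z∈X) = inj₂ (X⊆Γ z∈X)
      X∪l⊆ (inj₂ z∈l) = inj₁ (l⊆B z∈l)
      head : BrF B ((X ∪ (_∈ l)) ∩ names B)
      head = BrF-resp-≐ B (branches-BrF B l∈)
        ( (λ z∈l → inj₂ z∈l , l⊆B z∈l)
        , λ { (inj₁ z∈X , z∈B) → ⊥-elim (X∩B-empty z∈X z∈B) ; (inj₂ z∈l , _) → z∈l } )
      tail : ∀ {C} → BrF C (X ∩ names C) × Disj (names B) (names C) → BrF C ((X ∪ (_∈ l)) ∩ names C)
      tail {C} (b , d) = BrF-resp-≐ C b
        ( map₁ inj₁
        , λ { (inj₁ z∈X , z∈C) → z∈X , z∈C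
            ; (inj₂ z∈l , z∈C) → ⊥-elim (d _ (l⊆B z∈l , z∈C)) } )

  BrL-∷⁻ : ∀ {B : Formula Atom} {Γ Z} → All (Disj (names B) ∘ names) Γ →
           BrL (B ∷ Γ) Z → BrL Γ (Z ∖ names B)
  BrL-∷⁻ {B} {Γ} {Z} disj (Z⊆ , _ ∷ bs) = Z∖B⊆Γ , All.zipWith tail (bs , disj)
    where
      Z∖B⊆Γ : Z ∖ names B ⊆ namesL Γ
      Z∖B⊆Γ (z∈Z , z∉B) with Z⊆ z∈Z
      ... | inj₁ z∈B = ⊥-elim (z∉B z∈B)
      ... | inj₂ z∈Γ = z∈Γ
      tail : ∀ {C} → BrF C (Z ∩ names C) × Disj (names B) (names C) → BrF C ((Z ∖ names B) ∩ names C)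
      tail {C} (b , d) = BrF-resp-≐ C b
        ( (λ (z∈Z , z∈C) → (z∈Z , λ z∈B → d _ (z∈B , z∈C)) , z∈C)
        , λ ((z∈Z , _) , z∈C) → z∈Z , z∈C )

  module _ (bar : Atom → Atom) where

    names-neg : ∀ (A : Formula Atom) → names (neg bar A) ≡ names A
    names-neg (at α x) = refl
    names-neg (B ∨ᶠ C) = cong₂ _∪_ (names-neg B) (names-neg C)
    names-neg (B ∧ᶠ C) = cong₂ _∪_ (names-neg B) (names-neg C)

    SharingFreeF-neg : ∀ (A : Formula Atom) → SharingFreeF A → SharingFreeF (neg bar A)
    SharingFreeF-neg (at α x) _ = _
    SharingFreeF-neg (B ∨ᶠ C) (sB , sC , d) =
      SharingFreeF-neg B sB , SharingFreeF-neg C sC , subst₂ Disj (sym (names-neg B)) (sym (names-neg C)) d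
    SharingFreeF-neg (B ∧ᶠ C) (sB , sC , d) =
      SharingFreeF-neg B sB , SharingFreeF-neg C sC , subst₂ Disj (sym (names-neg B)) (sym (names-neg C)) d

    SharingFree-neg : ∀ {A Γ} → SharingFree (A ∷ Γ) → SharingFree (neg bar A ∷ Γ)
    SharingFree-neg {A} {Γ} (sA ∷ sΓ , d ∷ ds) =
      SharingFreeF-neg A sA ∷ sΓ , subst (λ I → All (Disj I ∘ names) Γ) (sym (names-neg A)) d ∷ ds

    atomOf-neg : ∀ (A : Formula Atom) z → atomOf (neg bar A) z ≡ Maybe.map bar (atomOf A z)
    atomOf-neg (at α x) z with z ℕ.≟ x
    ... | yes _ = refl
    ... | no  _ = refl
    atomOf-neg (B ∨ᶠ C) z rewrite atomOf-neg B z | atomOf-neg C z with atomOf B z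
    ... | just _  = refl
    ... | nothing = refl
    atomOf-neg (B ∧ᶠ C) z rewrite atomOf-neg B z | atomOf-neg C z with atomOf B z
    ... | just _  = refl
    ... | nothing = refl

    branches-complementary : ∀ (A : Formula Atom) (σ : Name → Bool) →
      (∃[ l ] (l ∈ branches A × All ((_≡ true) ∘ σ) l)) ⊎
      (∃[ l ] (l ∈ branches (neg bar A) × All ((_≡ false) ∘ σ) l))
    branches-complementary (at α x) σ with σ x in σx
    ... | true  = inj₁ ([ x ] , here refl , σx ∷ [])
    ... | false = inj₂ ([ x ] , here refl , σx ∷ [])
    branches-complementary (B ∨ᶠ C) σ with branches-complementary B σ | branches-complementary C σ
    ... | inj₂ (l , l∈ , all) | _ = inj₂ (l , ∈-++⁺ˡ l∈ , all)
    ... | inj₁ _ | inj₂ (l , l∈ , all) = inj₂ (l , ∈-++⁺ʳ (branches (neg bar B)) l∈ , all)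
    ... | inj₁ (l₁ , l₁∈ , all₁) | inj₁ (l₂ , l₂∈ , all₂) =
      inj₁ (l₁ ++ l₂ , ∈-cartesianProductWith⁺ _++_ l₁∈ l₂∈ , All.++⁺ all₁ all₂)
    branches-complementary (B ∧ᶠ C) σ with branches-complementary B σ | branches-complementary C σ
    ... | inj₁ (l , l∈ , all) | _ = inj₁ (l , ∈-++⁺ˡ l∈ , all)
    ... | inj₂ _ | inj₁ (l , l∈ , all) = inj₁ (l , ∈-++⁺ʳ (branches B) l∈ , all)
    ... | inj₂ (l₁ , l₁∈ , all₁) | inj₂ (l₂ , l₂∈ , all₂) =
      inj₂ (l₁ ++ l₂ , ∈-cartesianProductWith⁺ _++_ l₁∈ l₂∈ , All.++⁺ all₁ all₂)

-- Labellings by atoms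

module _ {Atom : Set} (bar : Atom → Atom) where

  Dual : (Name → Maybe Atom) → Name → Name → Set
  Dual κ x y = ∃[ α ] (κ x ≡ just α × κ y ≡ just (bar α))

  Dual-next : ∀ {κ x y α} → Dual κ x y → κ x ≡ just α → κ y ≡ just (bar α)
  Dual-next (β , κx , κy) κx′ = trans κy (cong (just ∘ bar) (just-injective (trans (sym κx) κx′)))

module Relabelling {Atom : Set} (bar : Atom → Atom) (bar-invol : ∀ α → bar (bar α) ≡ α)
  (N : List Name) (κ κ̄ : Name → Maybe Atom)
  (κ̄-inside : ∀ {x} → x ∈ N → κ̄ x ≡ Maybe.map bar (κ x))
  (κ̄-outside : ∀ {x} → x ∉ N → κ̄ x ≡ κ x) where

  -- κ and κ̄ label the premises ⊢ Γ,A and ⊢ Γ,Ā, N being names(A); κᵇ b is the labelling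
  -- seen by G for b = true and by H for b = false.
  κᵇ : Bool → Name → Maybe Atom
  κᵇ b = if b then κ else κ̄

  κᵇ-outside : ∀ b {x} → x ∉ N → κᵇ b x ≡ κ x
  κᵇ-outside true  _  = refl
  κᵇ-outside false x∉ = κ̄-outside x∉

  κᵇ-flip : ∀ b {x α} → x ∈ N → κᵇ b x ≡ just α → κᵇ (not b) x ≡ just (bar α)
  κᵇ-flip true  x∈ κx = trans (κ̄-inside x∈) (cong (Maybe.map bar) κx)
  κᵇ-flip false x∈ κ̄x = map-bar⁻¹ (trans (sym (κ̄-inside x∈)) κ̄x)
    where
      map-bar⁻¹ : ∀ {m α} → Maybe.map bar m ≡ just α → m ≡ just (bar α)
      map-bar⁻¹ {just γ} refl = cong just (sym (bar-invol γ))

  Dual-cross : ∀ b {x y α} → Dual bar (κᵇ b) x y → y ∈ N →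
               κᵇ b x ≡ just α → κᵇ (not b) y ≡ just α
  Dual-cross b {α = α} d y∈ κx =
    trans (κᵇ-flip b y∈ (Dual-next bar {κᵇ b} d κx)) (cong just (bar-invol α))

  Dual-exit : ∀ b {x y α} → Dual bar (κᵇ b) x y → y ∉ N → κᵇ b x ≡ just α → κ y ≡ just (bar α)
  Dual-exit b d y∉ κx = trans (sym (κᵇ-outside b y∉)) (Dual-next bar {κᵇ b} d κx)

  Dual-inside : ∀ b {x y} → Dual bar (κᵇ b) x y → x ∈ N → y ∈ N → Dual bar κ x y
  Dual-inside true  d                _  _  = d
  Dual-inside false (β , κ̄x , κ̄y) x∈ y∈ = bar β , κᵇ-flip false x∈ κ̄x , κᵇ-flip false y∈ κ̄y

module _ {Atom : Set} (bar : Atom → Atom) (κ : Name → Maybe Atom) where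

  Separates : List Name → (Name → Bool) → Set
  Separates L c = ∀ {x y α} → x ∈ L → y ∈ L → κ x ≡ just α →
                  (κ y ≡ just α → c x ≡ c y) × (κ y ≡ just (bar α) → c x ≢ c y)

  -- Classical, since atoms need not have decidable equality.
  module _ (bar-invol : ∀ α → bar (bar α) ≡ α) (bar-irrefl : ∀ α → bar α ≢ α) where

    private
      Fits : List Name → (Name → Bool) → Name → Bool → Set
      Fits L c n b = ∀ {w α} → w ∈ L → κ n ≡ just α →
                     (κ w ≡ just α → b ≡ c w) × (κ w ≡ just (bar α) → b ≢ c w)

      _[_↦_] : (Name → Bool) → Name → Bool → Name → Bool
      (c [ n ↦ b ]) z with z ℕ.≟ n
      ... | yes _ = b
      ... | no  _ = c z

      ∈-∷⁻ : ∀ {x n} {L : List Name} → x ∈ n ∷ L → x ≢ n → x ∈ L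
      ∈-∷⁻ (here x≡n) x≢n = ⊥-elim (x≢n x≡n)
      ∈-∷⁻ (there x∈) _   = x∈

      Separates-∷ : ∀ {n L c b} → Separates L c → Fits L c n b → Separates (n ∷ L) (c [ n ↦ b ])
      Separates-∷ {n} sep fits {x} {y} {α} x∈ y∈ κx with x ℕ.≟ n | y ℕ.≟ n
      ... | yes refl | yes refl =
        (λ _ → refl) , λ κy → ⊥-elim (bar-irrefl α (just-injective (trans (sym κy) κx)))
      ... | yes refl | no y≢n   = fits (∈-∷⁻ y∈ y≢n) κx
      ... | no x≢n   | yes refl =
        (λ κy → sym (proj₁ (fits (∈-∷⁻ x∈ x≢n) κy) κx)) ,
        (λ κy cx≡b → proj₂ (fits (∈-∷⁻ x∈ x≢n) κy) (trans κx (cong just (sym (bar-invol α))))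
                           (sym cx≡b))
      ... | no x≢n   | no y≢n   = sep (∈-∷⁻ x∈ x≢n) (∈-∷⁻ y∈ y≢n) κx

      SameAtom DualAtom : List Name → Name → Set
      SameAtom L n = ∃[ w ] (w ∈ L × ∃[ α ] (κ n ≡ just α × κ w ≡ just α))
      DualAtom L n = ∃[ w ] (w ∈ L × ∃[ α ] (κ n ≡ just α × κ w ≡ just (bar α)))

      fitting : ∀ {n L c} → Separates L c → Dec (SameAtom L n) → Dec (DualAtom L n) → ∃ (Fits L c n)
      fitting {n} {L} {c} sep (yes (w , w∈ , α , κn , κw)) _ = c w , fits
        where
          fits : Fits L c n (c w)
          fits w′∈ κn′ with just-injective (trans (sym κn) κn′)
          ... | refl = sep w∈ w′∈ κw
      fitting {n} {L} {c} sep (no ¬same) (yes (w , w∈ , α , κn , κw)) = not (c w) , fits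
        where
          fits : Fits L c n (not (c w))
          fits w′∈ κn′ with just-injective (trans (sym κn) κn′)
          ... | refl =
            (λ κw′ → ⊥-elim (¬same (_ , w′∈ , α , κn′ , κw′))) ,
            (λ κw′ nc≡ → not-¬ refl (sym (trans nc≡ (sym (proj₁ (sep w∈ w′∈ κw) κw′)))))
      fitting sep (no ¬same) (no ¬dual) =
        true , λ w∈ κn → (λ κw → ⊥-elim (¬same (_ , w∈ , _ , κn , κw)))
                       , (λ κw → ⊥-elim (¬dual (_ , w∈ , _ , κn , κw)))

    ¬¬-separating : ∀ L → ¬ ¬ (∃ (Separates L))
    ¬¬-separating []      ¬sep = ¬sep ((λ _ → true) , λ ())
    ¬¬-separating (n ∷ L) ¬sep =
      ¬¬-separating L λ (c , sep) →
      ¬¬-excluded-middle λ same? →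
      ¬¬-excluded-middle λ dual? →
      let (b , fits) = fitting sep same? dual? in ¬sep (c [ n ↦ b ] , Separates-∷ sep fits)

-- Complete alternating paths

module CompletePaths {Atom : Set} (bar : Atom → Atom)
  (bar-invol : ∀ α → bar (bar α) ≡ α) (bar-irrefl : ∀ α → bar α ≢ α)
  (N : List Name) (κ κ̄ : Name → Maybe Atom)
  (κ̄-inside : ∀ {x} → x ∈ N → κ̄ x ≡ Maybe.map bar (κ x))
  (κ̄-outside : ∀ {x} → x ∉ N → κ̄ x ≡ κ x)
  (E : Bool → List (Name × Name))
  (E-dual : ∀ b {x y} → (x , y) ∈ E b → Dual bar (if b then κ else κ̄) x y)
  (covering : ∀ (σ : Name → Bool) → ∃[ b ] ∃[ x ] ∃[ y ]
                ((x , y) ∈ E b × (x ∈ N → σ x ≡ b) × (y ∈ N → σ y ≡ b)))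
  where

  open Relabelling bar bar-invol N κ κ̄ κ̄-inside κ̄-outside
  open import Data.List.Membership.DecPropositional ℕ._≟_ using (_∈?_)
  open import Data.List.Relation.Unary.Unique.DecPropositional ℕ._≟_ using (unique?)
  import Data.List.Membership.DecPropositional (≡-dec ℕ._≟_ ℕ._≟_) as Pairs

  Edge : Bool → Name → Name → Set
  Edge b x y = (x , y) ∈ E b ⊎ (y , x) ∈ E b

  Edge? : ∀ b x y → Dec (Edge b x y)
  Edge? b x y = ((x , y) Pairs.∈? E b) ⊎-dec ((y , x) Pairs.∈? E b)

  Edge-sym : ∀ {b x y} → Edge b x y → Edge b y x
  Edge-sym = Data.Sum.swap

  Edge-dual : ∀ b {x y} → Edge b x y → Dual bar (κᵇ b) x y
  Edge-dual b (inj₁ xy∈) = E-dual b xy∈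
  Edge-dual b (inj₂ yx∈) with E-dual b yx∈
  ... | α , κy , κx = bar α , κx , trans κy (cong just (sym (bar-invol α)))

  Edge-irrefl : ∀ b {x y} → Edge b x y → x ≢ y
  Edge-irrefl b e refl with Edge-dual b e
  ... | α , κx , κx′ = bar-irrefl α (just-injective (trans (sym κx′) κx))

  Alternating : Bool → List Name → Set
  Alternating b []          = ⊤
  Alternating b (x ∷ [])    = ⊤
  Alternating b (x ∷ y ∷ p) = Edge b x y × Alternating (not b) (y ∷ p)

  Alternating? : ∀ b p → Dec (Alternating b p)
  Alternating? b []          = yes tt
  Alternating? b (x ∷ [])    = yes tt
  Alternating? b (x ∷ y ∷ p) = Edge? b x y ×-dec Alternating? (not b) (y ∷ p)

  CompleteAltPath : Name → List Name → Name → Set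
  CompleteAltPath x mid y = x ∉ N × y ∉ N × All (_∈ N) mid × Unique (x ∷ mid ++ [ y ])
                          × ∃[ b ] Alternating b (x ∷ mid ++ [ y ])

  CompleteAltPath? : ∀ x mid y → Dec (CompleteAltPath x mid y)
  CompleteAltPath? x mid y =
    ¬? (x ∈? N) ×-dec ¬? (y ∈? N) ×-dec All.all? (_∈? N) mid ×-dec unique? _ ×-dec
    map′ [ (true ,_) , (false ,_) ]′ (λ { (true , a) → inj₁ a ; (false , a) → inj₂ a })
         (Alternating? true _ ⊎-dec Alternating? false _)

  -- A state (v , b) records that v ∈ N was entered by an edge of graph b; the walk leaves
  -- it in graph not b.
  State : Set
  State = Name × Bool

  Enter : Name → State → Set
  Enter o (w , b) = o ∉ N × Edge b o w × w ∈ N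

  Step : State → State → Set
  Step (v , b) (w , b′) = Edge b′ v w × w ∈ N × b′ ≡ not b

  Exit : Name → State → Set
  Exit o (v , b) = Edge (not b) v o × o ∉ N

  CompleteWalk : Name → List State → Name → Set
  CompleteWalk o []       o′ = o ∉ N × o′ ∉ N × ∃[ b ] Edge b o o′
  CompleteWalk o (s ∷ ss) o′ = Enter o s × Chain Step (Exit o′) s ss

  -- A walk starting from an atom α sees α at every state in the graph it leaves by. Hence a
  -- vertex occurs in one mode only, and shortcutting the states shortcuts the vertices.
  Polarised : Atom → State → Set
  Polarised α (v , b) = v ∈ N × κᵇ (not b) v ≡ just α

  Enter-polarised : ∀ {o α} w b → κᵇ b o ≡ just α → Enter o (w , b) → Polarised α (w , b)
  Enter-polarised w b κo (_ , e , w∈) = w∈ , Dual-cross b (Edge-dual b e) w∈ κo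

  Step-polarised : ∀ {α} s t → Polarised α s → Step s t → Polarised α t
  Step-polarised (v , b) (w , _) (_ , κv) (e , w∈ , refl) =
    w∈ , Dual-cross (not b) (Edge-dual (not b) e) w∈ κv

  Exit-polarised : ∀ {α o} s → Polarised α s → Exit o s → κ o ≡ just (bar α)
  Exit-polarised (v , b) (_ , κv) (e , o∉) = Dual-exit (not b) (Edge-dual (not b) e) o∉ κv

  Chain-polarised : ∀ {α o} s ss → Polarised α s → Chain Step (Exit o) s ss →
                    All (Polarised α) (s ∷ ss) × κ o ≡ just (bar α)
  Chain-polarised s []       pol ex       = pol ∷ [] , Exit-polarised s pol ex
  Chain-polarised s (t ∷ ss) pol (st , c) with Chain-polarised t ss (Step-polarised s t pol st) c
  ... | pols , κo = pol ∷ pols , κo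

  polarised-mode : ∀ {α v b b′} → Polarised α (v , b) → Polarised α (v , b′) → b ≡ b′
  polarised-mode {b = true}  {true}  _ _ = refl
  polarised-mode {b = false} {false} _ _ = refl
  polarised-mode {α} {b = true}  {false} (v∈ , κ̄v) (_ , κv) =
    ⊥-elim (bar-irrefl α (just-injective (trans (sym (κᵇ-flip true v∈ κv)) κ̄v)))
  polarised-mode {α} {b = false} {true} (_ , κv) (v∈ , κ̄v) =
    ⊥-elim (bar-irrefl α (just-injective (trans (sym (κᵇ-flip true v∈ κv)) κ̄v)))

  Unique-vertices : ∀ {α} ss → Unique ss → All (Polarised α) ss → Unique (map proj₁ ss)
  Unique-vertices []             _        _            = []
  Unique-vertices ((v , b) ∷ ss) (s∉ ∷ u) (pol ∷ pols) =
    All.map⁺ (All.zipWith distinct (s∉ , pols)) ∷ Unique-vertices ss u pols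
    where
      distinct : ∀ {t} → (v , b) ≢ t × Polarised _ t → v ≢ proj₁ t
      distinct (s≢t , pol′) refl = s≢t (cong (v ,_) (polarised-mode pol pol′))

  Chain-alternating : ∀ {o} v b us → Chain Step (Exit o) (v , b) us →
                      Alternating (not b) (v ∷ map proj₁ us ++ [ o ])
  Chain-alternating v b []                (e , _)              = e , tt
  Chain-alternating v b ((w , _) ∷ us) ((e , _ , refl) , c) = e , Chain-alternating w (not b) us c

  completeWalk⇒path : ∀ {o ss o′} → CompleteWalk o ss o′ → ∃[ mid ] CompleteAltPath o mid o′
  completeWalk⇒path {o} {[]} {o′} (o∉ , o′∉ , b , e) =
    [] , o∉ , o′∉ , [] , (Edge-irrefl b e ∷ []) ∷ [] ∷ [] , b , e , tt
  completeWalk⇒path {o} {(w , b) ∷ ss} {o′} (en@(o∉ , e , _) , c)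
    with Edge-dual b e | Chain-shortcut Step (≡-dec ℕ._≟_ _≟ᵇ_) (w , b) ss c
  ... | α , κo , _ | us , c′ , u with Chain-polarised (w , b) us (Enter-polarised w b κo en) c′
  ... | pols , κo′ = mid , o∉ , o′∉ , mid⊆N , unique , b , e , Chain-alternating w b us c′
    where
      mid : List Name
      mid = map proj₁ ((w , b) ∷ us)
      mid⊆N : All (_∈ N) mid
      mid⊆N = All.map⁺ (All.map proj₁ pols)
      o′∉ : o′ ∉ N
      o′∉ = proj₂ (proj₂ (Chain-final Step (w , b) us c′))
      o≢o′ : o ≢ o′
      o≢o′ refl = bar-irrefl α (just-injective (trans (sym κo′) (trans (sym (κᵇ-outside b o∉)) κo)))
      unique : Unique (o ∷ mid ++ [ o′ ])
      unique = All.++⁺ (All.map (λ z∈ o≡z → o∉ (subst (_∈ N) (sym o≡z) z∈)) mid⊆N) (o≢o′ ∷ [])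
             ∷ UniqueP.++⁺ (Unique-vertices _ u pols) ([] ∷ [])
                 (λ { (z∈mid , here refl) → o′∉ (All.lookup mid⊆N z∈mid) })

  data Reachable : State → Set where
    entered : ∀ {o s} → Enter o s → Reachable s
    stepped : ∀ {s t} → Reachable s → Step s t → Reachable t

  Reachable-∈ : ∀ {v b} → Reachable (v , b) → v ∈ N
  Reachable-∈ (entered {s = _ , _} (_ , _ , w∈)) = w∈
  Reachable-∈ (stepped {t = _ , _} _ (_ , w∈ , _)) = w∈

  Reachable⇒walk : ∀ {s} → Reachable s →
                   ∃[ o ] ∃[ s₀ ] ∃[ ss ] (Enter o s₀ × Chain Step (_≡ s) s₀ ss)
  Reachable⇒walk (entered {o} {s} en) = o , s , [] , en , refl
  Reachable⇒walk (stepped {t = t} r st) with Reachable⇒walk r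
  ... | o , s₀ , ss , en , c = o , s₀ , ss ++ [ t ] , en , Chain-snoc Step ss c st

  Reachable-reverse : ∀ {v b} → Reachable (v , b) → ∃[ o ] ∃[ rs ] Chain Step (Exit o) (v , not b) rs
  Reachable-reverse (entered {o} {_ , true}  (o∉ , e , _)) = o , [] , Edge-sym e , o∉
  Reachable-reverse (entered {o} {_ , false} (o∉ , e , _)) = o , [] , Edge-sym e , o∉
  Reachable-reverse (stepped {v , true} {_ , _} r (e , _ , refl)) with Reachable-reverse r
  ... | o , rs , c = o , (v , false) ∷ rs , (Edge-sym e , Reachable-∈ r , refl) , c
  Reachable-reverse (stepped {v , false} {_ , _} r (e , _ , refl)) with Reachable-reverse r
  ... | o , rs , c = o , (v , true) ∷ rs , (Edge-sym e , Reachable-∈ r , refl) , c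

  module _ (no-walk : ∀ {o ss o′} → ¬ CompleteWalk o ss o′) where

    modes-exclusive : ∀ {a b} → Reachable (a , b) → ¬ Reachable (a , not b)
    modes-exclusive r r′ with Reachable⇒walk r′ | Reachable-reverse r
    ... | o , s₀ , ss , en , c | o′ , rs , c′ =
      no-walk {ss = s₀ ∷ ss ++ rs} (en , Chain-++ Step ss rs c c′)

    module Sides (reachable? : Decidable Reachable) (c : Name → Bool) where

      -- A name is never reached through an edge of its own side.
      side : Name → Bool
      side a with reachable? (a , true) | reachable? (a , false)
      ... | yes _ | _     = false
      ... | no  _ | yes _ = true
      ... | no  _ | no  _ = c a

      side-reachable : ∀ {a} b → Reachable (a , b) → side a ≡ not b
      side-reachable {a} b r with reachable? (a , true) | reachable? (a , false)
      side-reachable true  r  | yes _  | _      = refl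
      side-reachable false r  | yes rt | _      = ⊥-elim (modes-exclusive r rt)
      side-reachable true  r  | no ¬rt | _      = ⊥-elim (¬rt r)
      side-reachable false r  | no _   | yes _  = refl
      side-reachable false r  | no _   | no ¬rf = ⊥-elim (¬rf r)

      unreachable-on-side : ∀ {a b} → side a ≡ b → ¬ Reachable (a , b)
      unreachable-on-side {b = b} side≡b r = not-¬ refl (trans (sym side≡b) (side-reachable b r))

      side-unreachable : ∀ {a} b → ¬ Reachable (a , b) → ¬ Reachable (a , not b) → side a ≡ c a
      side-unreachable {a} b ¬r ¬r′ with reachable? (a , true) | reachable? (a , false)
      ... | no _ | no _ = refl
      side-unreachable true  ¬r ¬r′ | yes r | _     = ⊥-elim (¬r r)
      side-unreachable false ¬r ¬r′ | yes r | _     = ⊥-elim (¬r′ r)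
      side-unreachable true  ¬r ¬r′ | no _  | yes r = ⊥-elim (¬r′ r)
      side-unreachable false ¬r ¬r′ | no _  | yes r = ⊥-elim (¬r r)

      entry-on-side : ∀ b {x y} → Edge b x y → x ∉ N → y ∈ N → side y ≢ b
      entry-on-side b e x∉ y∈ side≡b = unreachable-on-side side≡b (entered (x∉ , e , y∈))

      unreachable-pair : ∀ b {x y} → Edge b x y → x ∈ N → side x ≡ b → side y ≡ b → side y ≡ c y
      unreachable-pair b e x∈ side-x side-y =
        side-unreachable b (unreachable-on-side side-y)
          (λ r → unreachable-on-side side-x (stepped r (Edge-sym e , x∈ , sym (not-involutive b))))

      edge-contradiction : Separates bar κ N c → ∀ b {x y} → Edge b x y →
                           (x ∈ N → side x ≡ b) → (y ∈ N → side y ≡ b) → ⊥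
      edge-contradiction sep b {x} {y} e x-side y-side with x ∈? N | y ∈? N
      ... | no  x∉ | no  y∉ = no-walk {ss = []} (x∉ , y∉ , b , e)
      ... | no  x∉ | yes y∈ = entry-on-side b e x∉ y∈ (y-side y∈)
      ... | yes x∈ | no  y∉ = entry-on-side b (Edge-sym e) y∉ x∈ (x-side x∈)
      ... | yes x∈ | yes y∈ with Dual-inside b (Edge-dual b e) x∈ y∈
      ... | α , κx , κy = proj₂ (sep x∈ y∈ κx) κy (begin
            c x     ≡⟨ sym (unreachable-pair b (Edge-sym e) y∈ (y-side y∈) (x-side x∈)) ⟩
            side x  ≡⟨ x-side x∈ ⟩
            b       ≡⟨ sym (y-side y∈) ⟩
            side y  ≡⟨ unreachable-pair b e x∈ (x-side x∈) (y-side y∈) ⟩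
            c y     ∎)
        where open ≡-Reasoning

  ¬¬completeWalk : ¬ ¬ (∃[ o ] ∃[ ss ] ∃[ o′ ] CompleteWalk o ss o′)
  ¬¬completeWalk ¬walk =
    ¬¬-decidable (≡-dec ℕ._≟_ _≟ᵇ_) (cartesianProduct N (true ∷ false ∷ [])) state∈
      λ reachable? → ¬¬-separating bar κ bar-invol bar-irrefl N λ (c , sep) →
      let open Sides no-walk reachable? c
          (b , x , y , xy∈ , x-side , y-side) = covering side
      in edge-contradiction sep b (inj₁ xy∈) x-side y-side
    where
      no-walk : ∀ {o ss o′} → ¬ CompleteWalk o ss o′
      no-walk w = ¬walk (_ , _ , _ , w)
      state∈ : ∀ {s} → Reachable s → s ∈ cartesianProduct N (true ∷ false ∷ [])
      state∈ {_ , true}  r = ∈-cartesianProduct⁺ (Reachable-∈ r) (here refl)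
      state∈ {_ , false} r = ∈-cartesianProduct⁺ (Reachable-∈ r) (there (here refl))

  edges : List (Name × Name)
  edges = E true ++ E false

  endpoints : List Name
  endpoints = map proj₁ edges ++ map proj₂ edges

  ∈-edges : ∀ b {e} → e ∈ E b → e ∈ edges
  ∈-edges true  = ∈-++⁺ˡ
  ∈-edges false = ∈-++⁺ʳ (E true)

  Edge-endpoints : ∀ b {x y} → Edge b x y → x ∈ endpoints × y ∈ endpoints
  Edge-endpoints b e with Data.Sum.map (∈-edges b) (∈-edges b) e
  ... | inj₁ xy∈ = ∈-++⁺ˡ (∈-map⁺ proj₁ xy∈) , ∈-++⁺ʳ (map proj₁ edges) (∈-map⁺ proj₂ xy∈)
  ... | inj₂ yx∈ = ∈-++⁺ʳ (map proj₁ edges) (∈-map⁺ proj₂ yx∈) , ∈-++⁺ˡ (∈-map⁺ proj₁ yx∈)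

  Alternating-endpoints : ∀ b x mid y → Alternating b (x ∷ mid ++ [ y ]) → x ∈ endpoints × y ∈ endpoints
  Alternating-endpoints b x []        y (e , _) = Edge-endpoints b e
  Alternating-endpoints b x (m ∷ mid) y (e , a) =
    proj₁ (Edge-endpoints b e) , proj₂ (Alternating-endpoints (not b) m mid y a)

  PathThrough : List Name → Set
  PathThrough mid = Any (λ x → Any (λ y → CompleteAltPath x mid y) endpoints) endpoints

  PathThrough? : Decidable PathThrough
  PathThrough? mid = any? (λ x → any? (λ y → CompleteAltPath? x mid y) endpoints) endpoints

  completeAltPath : ∃[ x ] ∃[ mid ] ∃[ y ] CompleteAltPath x mid y
  completeAltPath with boundedSearch N PathThrough? (length N)
  ... | yes (mid , _ , _ , through) with Any.satisfied through
  ...   | x , through′ with Any.satisfied through′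
  ...     | y , path = x , mid , y , path
  completeAltPath | no none =
    ⊥-elim (¬¬completeWalk λ (_ , _ , _ , w) → none (bounded (completeWalk⇒path w)))
    where
      bounded : ∀ {o o′} → ∃[ mid ] CompleteAltPath o mid o′ → Bounded N (length N) PathThrough
      bounded (mid , path@(_ , _ , mid⊆N , _ ∷ u , b , alt)) with Alternating-endpoints b _ mid _ alt
      ... | o∈ , o′∈ =
        mid , Unique-length≤ (Unique-++⁻ˡ mid u) mid⊆N , mid⊆N , lose o∈ (lose o′∈ path)

-- Composition of total bl-graphs

module _ {K : RawBL} (K-bl : IsBLGraph K) where
  open IsBLGraph K-bl

  RelI-sym : ∀ {I x y X} → RelI K I x y X → RelI K I y x X
  RelI-sym (Y , r , X≐) = Y , rel-sym r , X≐

  RelI-V : ∀ {I x y X} → RelI K I x y X → V K x × V K y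
  RelI-V (Y , r , _) = rel-V r (proj₁ (rel-edge r)) , rel-V r (proj₂ (rel-edge r))

module _ {I X : NSet} where

  Alt-first : ∀ {K₁ K₂} x p y → Alt K₁ K₂ I X (x ∷ p ++ [ y ]) → ∃[ z ] RelI K₁ I x z X
  Alt-first x []      y (e , _) = y , e
  Alt-first x (m ∷ p) y (e , _) = m , e

  Alt-vertices : ∀ {K₁ K₂} → IsBLGraph K₁ → IsBLGraph K₂ → ∀ x p y →
                 Alt K₁ K₂ I X (x ∷ p ++ [ y ]) → All (V K₁ ∪ V K₂) (x ∷ p ++ [ y ])
  Alt-vertices bl₁ _   x []      y (e , _) =
    inj₁ (proj₁ (RelI-V bl₁ e)) ∷ inj₁ (proj₂ (RelI-V bl₁ e)) ∷ []
  Alt-vertices bl₁ bl₂ x (m ∷ p) y (e , alt) =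
    inj₁ (proj₁ (RelI-V bl₁ e)) ∷ All.map Data.Sum.swap (Alt-vertices bl₂ bl₁ m p y alt)

module Premise {Atom : Set} {bar : Atom → Atom} (bar-invol : ∀ α → bar (bar α) ≡ α)
  {Γ : List (Formula Atom)} {B : Formula Atom} (sf : SharingFree (B ∷ Γ))
  {K : RawBL} (K-bl : IsBLGraph K) (K-total : Total bar K (B ∷ Γ)) where

  private
    module K = IsBLGraph K-bl
    module T = Total K-total

  disjoint : All (Disj (names B) ∘ names) Γ
  disjoint with proj₂ sf
  ... | d ∷ _ = d

  rel-dual : ∀ {x y Y} → rel K x y Y → Dual bar (atomsOf (B ∷ Γ)) x y
  rel-dual r with namesL⇒AtomAt (B ∷ Γ) (proj₁ T.tot-V (K.rel-V r (proj₁ (K.rel-edge r))))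
                | namesL⇒AtomAt (B ∷ Γ) (proj₁ T.tot-V (K.rel-V r (proj₂ (K.rel-edge r))))
  ... | α , x:α | β , y:β =
    α , AtomAt⇒atomsOf (B ∷ Γ) sf x:α ,
    trans (AtomAt⇒atomsOf (B ∷ Γ) sf y:β)
          (cong just (trans (sym (bar-invol β)) (cong bar (sym (T.tot-ax r x:α y:β)))))

  vertex-outside : ∀ {z} → V K z → ¬ names B z → namesL Γ z
  vertex-outside z∈ z∉B with proj₁ T.tot-V z∈
  ... | inj₁ z∈B = ⊥-elim (z∉B z∈B)
  ... | inj₂ z∈Γ = z∈Γ

  vertex-inside : namesL Γ ⊆ V K
  vertex-inside = proj₂ T.tot-V ∘ inj₂

  RelI-branch : ∀ {x y X} → RelI K (names B) x y X → BrL Γ X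
  RelI-branch {x} {y} (Y , r , X≐) =
    BrL-resp-≐ Γ (≐-sym X≐) (BrL-∷⁻ disjoint (proj₁ (T.tot-Br Y) (x , y , Y , r , ≐-refl)))

  module Links {X : NSet} (bX : BrL Γ X) where

    private
      X∉B : ∀ {z} → X z → ¬ names B z
      X∉B = names-disjoint B Γ disjoint ∘ proj₁ bX

      linked : ∀ {l} → l ∈ branches B → BrG K (X ∪ (_∈ l))
      linked l∈ = proj₂ (T.tot-Br _) (BrL-∷⁺ disjoint bX l∈)

    link : ∀ {l} → l ∈ branches B → Name × Name
    link l∈ = proj₁ (linked l∈) , proj₁ (proj₂ (linked l∈))

    links : List (Name × Name)
    links = mapWith∈ (branches B) link

    link∈links : ∀ {l} (l∈ : l ∈ branches B) → link l∈ ∈ links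
    link∈links l∈ = AnyP.mapWith∈⁺ link (_ , l∈ , refl)

    link-ends : ∀ {l} (l∈ : l ∈ branches B) →
                All (λ z → ¬ names B z ⊎ z ∈ l) (proj₁ (link l∈) ∷ proj₂ (link l∈) ∷ [])
    link-ends {l} l∈ with linked l∈
    ... | _ , _ , Y , r , Y≐ = end (proj₁ (K.rel-edge r)) ∷ end (proj₂ (K.rel-edge r)) ∷ []
      where
        end : ∀ {z} → Y z → ¬ names B z ⊎ z ∈ l
        end z∈Y = Data.Sum.map₁ X∉B (proj₁ Y≐ z∈Y)

    links-RelI : ∀ {x y} → (x , y) ∈ links → RelI K (names B) x y X
    links-RelI xy∈ with AnyP.mapWith∈⁻ (branches B) link xy∈
    ... | _ , l∈ , refl with linked l∈
    ...   | _ , _ , Y , r , Y≐ =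
      Y , r , (λ z∈X → proj₂ Y≐ (inj₁ z∈X) , X∉B z∈X) ,
              (λ (z∈Y , z∉B) → [ id , (λ z∈l → ⊥-elim (z∉B (All.lookup (branches-⊆ B l∈) z∈l))) ]′
                                 (proj₁ Y≐ z∈Y))

module Cut {Atom : Set} {bar : Atom → Atom}
  (bar-invol : ∀ α → bar (bar α) ≡ α) (bar-irrefl : ∀ α → bar α ≢ α)
  {Γ : List (Formula Atom)} {A : Formula Atom} (sf : SharingFree (A ∷ Γ))
  {G H : RawBL} (G-bl : IsBLGraph G) (H-bl : IsBLGraph H)
  (G-total : Total bar G (A ∷ Γ)) (H-total : Total bar H (neg bar A ∷ Γ)) where

  private
    module G-premise = Premise bar-invol sf G-bl G-total
    module H-premise = Premise bar-invol (SharingFree-neg bar sf) H-bl H-total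

    names-Ā : names (neg bar A) ≡ names A
    names-Ā = names-neg bar A

  κ κ̄ : Name → Maybe Atom
  κ = atomsOf (A ∷ Γ)
  κ̄ = atomsOf (neg bar A ∷ Γ)

  κ̄-inside : ∀ {x} → x ∈ nameList A → κ̄ x ≡ Maybe.map bar (κ x)
  κ̄-inside {x} x∈ with names⇒AtomIn A (∈-nameList⁻ A x∈)
  ... | α , x:α rewrite atomOf-neg bar A x | AtomIn⇒atomOf A (All.head (proj₁ sf)) x:α = refl

  κ̄-outside : ∀ {x} → x ∉ nameList A → κ̄ x ≡ κ x
  κ̄-outside {x} x∉ rewrite atomOf-neg bar A x | atomOf-∉ A (x∉ ∘ ∈-nameList⁺ A) = refl

  open Relabelling bar bar-invol (nameList A) κ κ̄ κ̄-inside κ̄-outside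

  Gr : Bool → RawBL
  Gr true  = G
  Gr false = H

  rel-dual : ∀ b {x y Y} → rel (Gr b) x y Y → Dual bar (κᵇ b) x y
  rel-dual true  = G-premise.rel-dual
  rel-dual false = H-premise.rel-dual

  vertices : V (G ⊙[ names A ] H) ≐ namesL Γ
  vertices = outside , λ z∈Γ → inj₁ (G-premise.vertex-inside z∈Γ) ,
                                names-disjoint A Γ G-premise.disjoint z∈Γ
    where
      outside : V (G ⊙[ names A ] H) ⊆ namesL Γ
      outside (inj₁ z∈G , z∉A) = G-premise.vertex-outside z∈G z∉A
      outside (inj₂ z∈H , z∉A) = H-premise.vertex-outside z∈H (z∉A ∘ subst (λ I → I _) names-Ā)

  branch-sound : ∀ X → BrG (G ⊙[ names A ] H) X → BrL Γ X
  branch-sound X (x , y , Y , (_ , _ , _ , _ , mid , _ , _ , _ , _ , _ , alt) , Y≐X) =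
    BrL-resp-≐ Γ Y≐X (first-edge alt)
    where
      first-edge : Alt G H (names A) Y (x ∷ mid ++ [ y ]) ⊎ Alt H G (names A) Y (x ∷ mid ++ [ y ]) → BrL Γ Y
      first-edge (inj₁ alt) = G-premise.RelI-branch (proj₂ (Alt-first x mid y alt))
      first-edge (inj₂ alt) with Alt-first x mid y alt
      ... | z , e = H-premise.RelI-branch (subst (λ I → RelI H I x z Y) (sym names-Ā) e)

  Alt-dual : ∀ b x mid y {X α} → All (names A) mid → ¬ names A y →
             Alt (Gr b) (Gr (not b)) (names A) X (x ∷ mid ++ [ y ]) →
             κᵇ b x ≡ just α → κ y ≡ just (bar α)
  Alt-dual b     x []        y _           y∉ ((_ , r , _) , _) κx =
    Dual-exit b (rel-dual b r) (y∉ ∘ ∈-nameList⁻ A) κx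
  Alt-dual true  x (m ∷ mid) y (m∈ ∷ mid⊆) y∉ ((_ , r , _) , alt) κx =
    Alt-dual false m mid y mid⊆ y∉ alt (Dual-cross true (rel-dual true r) (∈-nameList⁺ A m∈) κx)
  Alt-dual false x (m ∷ mid) y (m∈ ∷ mid⊆) y∉ ((_ , r , _) , alt) κx =
    Alt-dual true m mid y mid⊆ y∉ alt (Dual-cross false (rel-dual false r) (∈-nameList⁺ A m∈) κx)

  axiom-dual : ∀ {x y X α β} → rel (G ⊙[ names A ] H) x y X →
               AtomAt Γ x α → AtomAt Γ y β → α ≡ bar β
  axiom-dual {x} {y} {α = α} {β} (_ , _ , _ , _ , mid , mid⊆ , x∉ , y∉ , _ , _ , alt)
             (C , C∈ , x:α) (C′ , C′∈ , y:β) =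
    trans (sym (bar-invol α)) (cong bar (just-injective (trans (sym κy-dual) κy)))
    where
      κx : κ x ≡ just α
      κx = AtomAt⇒atomsOf (A ∷ Γ) sf (C , there C∈ , x:α)
      κy : κ y ≡ just β
      κy = AtomAt⇒atomsOf (A ∷ Γ) sf (C′ , there C′∈ , y:β)
      κy-dual : κ y ≡ just (bar α)
      κy-dual = [ (λ alt → Alt-dual true x mid y mid⊆ y∉ alt κx)
                , (λ alt → Alt-dual false x mid y mid⊆ y∉ alt
                                     (trans (κ̄-outside (x∉ ∘ ∈-nameList⁻ A)) κx))
                ]′ alt

  module PathFor {X : NSet} (bX : BrL Γ X) where

    private
      module G-links = G-premise.Links bX
      module H-links = H-premise.Links bX

    E : Bool → List (Name × Name)
    E true  = G-links.links
    E false = H-links.links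

    E-RelI : ∀ b {x y} → (x , y) ∈ E b → RelI (Gr b) (names A) x y X
    E-RelI true  xy∈ = G-links.links-RelI xy∈
    E-RelI false xy∈ = subst (λ I → RelI H I _ _ X) names-Ā (H-links.links-RelI xy∈)

    E-dual : ∀ b {x y} → (x , y) ∈ E b → Dual bar (κᵇ b) x y
    E-dual b xy∈ with E-RelI b xy∈
    ... | _ , r , _ = rel-dual b r

    private
      A⊆Ā : ∀ {w} → names A w → names (neg bar A) w
      A⊆Ā = subst (λ I → I _) (sym names-Ā)

      end-side : ∀ {B : Formula Atom} {l z b} (σ : Name → Bool) → (∀ {w} → names A w → names B w) →
                 ¬ names B z ⊎ z ∈ l → All ((_≡ b) ∘ σ) l → z ∈ nameList A → σ z ≡ b
      end-side σ A⊆B (inj₁ z∉B) _       z∈ = ⊥-elim (z∉B (A⊆B (∈-nameList⁻ A z∈)))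
      end-side σ A⊆B (inj₂ z∈l) on-side _  = All.lookup on-side z∈l

    covering : ∀ (σ : Name → Bool) → ∃[ b ] ∃[ x ] ∃[ y ]
                 ((x , y) ∈ E b × (x ∈ nameList A → σ x ≡ b) × (y ∈ nameList A → σ y ≡ b))
    covering σ with branches-complementary bar A σ
    ... | inj₁ (l , l∈ , on-side) with G-links.link-ends l∈
    ...   | x-end ∷ y-end ∷ [] =
      true , _ , _ , G-links.link∈links l∈ ,
      end-side {A} σ id x-end on-side , end-side {A} σ id y-end on-side
    covering σ | inj₂ (l , l∈ , on-side) with H-links.link-ends l∈
    ...   | x-end ∷ y-end ∷ [] =
      false , _ , _ , H-links.link∈links l∈ ,
      end-side {neg bar A} σ A⊆Ā x-end on-side , end-side {neg bar A} σ A⊆Ā y-end on-side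

    open CompletePaths bar bar-invol bar-irrefl (nameList A) κ κ̄ κ̄-inside κ̄-outside E E-dual covering public

    Edge⇒RelI : ∀ b {x y} → Edge b x y → RelI (Gr b) (names A) x y X
    Edge⇒RelI b     (inj₁ xy∈) = E-RelI b xy∈
    Edge⇒RelI true  (inj₂ yx∈) = RelI-sym G-bl (E-RelI true yx∈)
    Edge⇒RelI false (inj₂ yx∈) = RelI-sym H-bl (E-RelI false yx∈)

    Alternating⇒Alt : ∀ b p → Alternating b p → Alt (Gr b) (Gr (not b)) (names A) X p
    Alternating⇒Alt b     []          _       = _
    Alternating⇒Alt b     (x ∷ [])    _       = _
    Alternating⇒Alt true  (x ∷ y ∷ p) (e , a) = Edge⇒RelI true e , Alternating⇒Alt false (y ∷ p) a
    Alternating⇒Alt false (x ∷ y ∷ p) (e , a) = Edge⇒RelI false e , Alternating⇒Alt true (y ∷ p) a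

    orient : ∀ b p → Alternating b p → Alt G H (names A) X p ⊎ Alt H G (names A) X p
    orient true  p a = inj₁ (Alternating⇒Alt true p a)
    orient false p a = inj₂ (Alternating⇒Alt false p a)

    path⇒rel : ∀ {x mid y} → CompleteAltPath x mid y → rel (G ⊙[ names A ] H) x y X
    path⇒rel {x} {mid} {y} (x∉ , y∉ , mid⊆ , unique@(x∉path ∷ _) , b , alt) =
      x≢y , (All.head path-V , x∉A) , (All.lookup path-V y∈path , y∉A) , X⊆V ,
      mid , All.map (∈-nameList⁻ A) mid⊆ , x∉A , y∉A , unique , path-V , alt′
      where
        x∉A : ¬ names A x
        x∉A = x∉ ∘ ∈-nameList⁺ A
        y∉A : ¬ names A y
        y∉A = y∉ ∘ ∈-nameList⁺ A
        y∈path : y ∈ x ∷ mid ++ [ y ]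
        y∈path = there (∈-++⁺ʳ mid (here refl))
        x≢y : x ≢ y
        x≢y = All.lookup x∉path (∈-++⁺ʳ mid (here refl))
        alt′ : Alt G H (names A) X (x ∷ mid ++ [ y ]) ⊎ Alt H G (names A) X (x ∷ mid ++ [ y ])
        alt′ = orient b _ alt
        path-V : All (V G ∪ V H) (x ∷ mid ++ [ y ])
        path-V = [ Alt-vertices G-bl H-bl x mid y
                 , All.map Data.Sum.swap ∘ Alt-vertices H-bl G-bl x mid y ]′ alt′
        X⊆V : X ⊆ V (G ⊙[ names A ] H)
        X⊆V z∈X = inj₁ (G-premise.vertex-inside (proj₁ bX z∈X)) ,
                  names-disjoint A Γ G-premise.disjoint (proj₁ bX z∈X)

  branch-complete : ∀ X → BrL Γ X → BrG (G ⊙[ names A ] H) X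
  branch-complete X bX =
    let open PathFor bX
        (x , mid , y , path) = completeAltPath
    in x , y , X , path⇒rel path , ≐-refl

corollary6 : (Atom : Set) (bar : Atom → Atom)
    → (∀ α → bar (bar α) ≡ α) → (∀ α → bar α ≢ α)
    → (Γ : List (Formula Atom)) (A : Formula Atom)
    → SharingFree (A ∷ Γ)
    → (G H : RawBL) → IsBLGraph G → IsBLGraph H
    → Total bar G (A ∷ Γ) → Total bar H (neg bar A ∷ Γ)
    → Total bar (G ⊙[ names A ] H) Γ
corollary6 Atom bar bar-invol bar-irrefl Γ A sf G H G-bl H-bl G-total H-total = record
  { tot-V  = vertices
  ; tot-Br = λ X → branch-sound X , branch-complete X
  ; tot-ax = axiom-dual
  }
  where open Cut bar-invol bar-irrefl sf G-bl H-bl G-total H-total
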